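{- For every integer $n\geq1$: \begin{gather*} 3F_{2n-1} = L_{4n-2}-4\sum_{k=1}^{n-1}F_{2k}L_{4n-4k-2},\\ 2F_{2n-1} -5F_{2n-2}= L_{4n-4}-4\sum_{k=1}^{n-1}F_{2k}L_{4n-4k-4},\\ 2F_{4n+2} -3F_{4n-2}= L_{2n}+L_{2n-2}+4\sum_{k=0}^{n-1}F_{4k+2}L_{2n-2k-2},\\ 2F_{4n} -3F_{4n-4}= 3L_{2n-2}+4\sum_{k=1}^{n-1}F_{4k}L_{2n-2k-2}. \end{gather*}
   Context: $F_n$ and $L_n$ are the Fibonacci and Lucas numbers: $u_n=u_{n-1}+u_{n-2}$ with $F_0=0,F_1=1$ and $L_0=2,L_1=1$. Empty sums are $0$. -}

module Defs where

open import Data.Nat using (ℕ; zero; suc)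
open import Data.Integer using (ℤ; +_; _+_)

F : ℕ → ℤ
F zero = + 0
F (suc zero) = + 1
F (suc (suc n)) = F (suc n) + F n

L : ℕ → ℤ
L zero = + 2
L (suc zero) = + 1
L (suc (suc n)) = L (suc n) + L n

-- Σ[k from a to b] f k  (inclusive range a..b; empty sum = 0 when b < a).
-- sumFrom a c f = f a + f (a+1) + ... + f (a+c-1)  (c terms)
sumFrom : ℕ → ℕ → (ℕ → ℤ) → ℤ
sumFrom a zero f = + 0
sumFrom a (suc c) f = f a + sumFrom (suc a) c f

-- Each sum, taken from k = 0 (the added term vanishes), is a convolution Σ_{k ≤ m} a_k g_{m-k} whose kernel
-- g (Lucas numbers along a progression of step 2 or 4) satisfies g_{i+2} = p g_{i+1} - g_i with
-- p = L₂ = 3 or L₄ = 7.  The convolution then satisfies the same recurrence with a forcing term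
-- built from a_{m+1}, a_{m+2}, g₀, g₁ alone.  The other side is x + y with x p-recurrent and
-- y q-recurrent ({p, q} = {3, 7}), so it satisfies the p-recurrence with forcing (q - p) y_{m+1};
-- this matches four times the convolution's forcing, and the two sides agree at m = 0, 1.
module Submission where

open import Defs
open import Data.Nat using (ℕ; _∸_; _≥_) renaming (_*_ to _*ₙ_; _+_ to _+ₙ_)
open import Data.Integer using (ℤ; +_; _+_; _-_; _*_)
open import Data.Product using (_×_)
open import Relation.Binary.PropositionalEquality using (_≡_)

open import Data.Nat using (zero; suc; _≤_; _<_; z≤n; z<s)
open import Data.Nat.Properties
  using (≤-refl; ≤-pred; <⇒≤; +-suc; *-comm; m<m+n; m+n∸m≡n; n∸n≡0; +-∸-assoc; m≤n⇒∃[o]m+o≡n)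
import Data.Nat.Properties as ℕₚ
open import Data.Integer using (-_)
open import Data.Integer.Properties using (+-identityˡ; +-identityʳ; +-assoc)
open import Data.Product using (_,_)
open import Relation.Binary.PropositionalEquality
  using (refl; sym; trans; cong; cong₂; subst; module ≡-Reasoning)
import Data.Integer.Tactic.RingSolver as ℤ-Solver
import Data.Nat.Tactic.RingSolver as ℕ-Solver

open ≡-Reasoning

FibonacciLike : (ℕ → ℤ) → Set
FibonacciLike u = ∀ k → u (suc (suc k)) ≡ u (suc k) + u k

F-fibonacciLike : FibonacciLike F
F-fibonacciLike _ = refl

L-fibonacciLike : FibonacciLike L
L-fibonacciLike _ = refl

module _ {u : ℕ → ℤ} (u-rec : FibonacciLike u) where

  fibonacciLike-addition : ∀ t k → u (suc t +ₙ k) ≡ F t * u k + F (suc t) * u (suc k)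
  fibonacciLike-addition zero k = base (u k) (u (suc k))
    where
    base : ∀ x y → y ≡ + 0 * x + + 1 * y
    base = ℤ-Solver.solve-∀
  fibonacciLike-addition (suc zero) k = trans (u-rec k) (step (u k) (u (suc k)))
    where
    step : ∀ x y → y + x ≡ + 1 * x + + 1 * y
    step = ℤ-Solver.solve-∀
  fibonacciLike-addition (suc (suc t)) k = begin
    u (suc (suc (suc t)) +ₙ k)
      ≡⟨ u-rec (suc t +ₙ k) ⟩
    u (suc (suc t) +ₙ k) + u (suc t +ₙ k)
      ≡⟨ cong₂ _+_ (fibonacciLike-addition (suc t) k) (fibonacciLike-addition t k) ⟩
    (F (suc t) * u k + F (suc (suc t)) * u (suc k)) + (F t * u k + F (suc t) * u (suc k))
      ≡⟨ add (F t) (F (suc t)) (u k) (u (suc k)) ⟩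
    F (suc (suc t)) * u k + F (suc (suc (suc t))) * u (suc k) ∎
    where
    add : ∀ a b x y → (b * x + (b + a) * y) + (a * x + b * y) ≡ (b + a) * x + ((b + a) + b) * y
    add = ℤ-Solver.solve-∀

  fibonacciLike-bisection : ∀ k → u (2 +ₙ (2 +ₙ k)) ≡ + 3 * u (2 +ₙ k) - u k
  fibonacciLike-bisection k = begin
    u (4 +ₙ k)                                ≡⟨ fibonacciLike-addition 3 k ⟩
    F 3 * u k + F 4 * u (suc k)               ≡⟨ combine (u k) (u (suc k)) ⟩
    + 3 * (F 1 * u k + F 2 * u (suc k)) - u k ≡⟨ cong (λ z → + 3 * z - u k) (fibonacciLike-addition 1 k) ⟨
    + 3 * u (2 +ₙ k) - u k                    ∎
    where
    combine : ∀ a b → + 2 * a + + 3 * b ≡ + 3 * (+ 1 * a + + 1 * b) - a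
    combine = ℤ-Solver.solve-∀

  fibonacciLike-quadrisection : ∀ k → u (4 +ₙ (4 +ₙ k)) ≡ + 7 * u (4 +ₙ k) - u k
  fibonacciLike-quadrisection k = begin
    u (8 +ₙ k)                                ≡⟨ fibonacciLike-addition 7 k ⟩
    F 7 * u k + F 8 * u (suc k)               ≡⟨ combine (u k) (u (suc k)) ⟩
    + 7 * (F 3 * u k + F 4 * u (suc k)) - u k ≡⟨ cong (λ z → + 7 * z - u k) (fibonacciLike-addition 3 k) ⟨
    + 7 * u (4 +ₙ k) - u k                    ∎
    where
    combine : ∀ a b → + 13 * a + + 21 * b ≡ + 7 * (+ 2 * a + + 3 * b) - a
    combine = ℤ-Solver.solve-∀

record Homogeneous (p : ℤ) (x : ℕ → ℤ) : Set where
  field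
    homogeneous-step : ∀ m → x (suc (suc m)) ≡ p * x (suc m) - x m

record Recurrence (p : ℤ) (r x : ℕ → ℤ) : Set where
  field
    recurrence-step : ∀ m → x (suc (suc m)) ≡ p * x (suc m) - x m + r m

open Homogeneous
open Recurrence

-- Indices are written d + m * c so that passing from m to suc m adds c definitionally; the
-- forcing identities below are checked by unfolding F and L on such indices.
section-homogeneous : ∀ {u : ℕ → ℤ} {p} c → (∀ k → u (c +ₙ (c +ₙ k)) ≡ p * u (c +ₙ k) - u k) →
                      ∀ d → Homogeneous p (λ m → u (d +ₙ m *ₙ c))
section-homogeneous {u} {p} c step d .homogeneous-step m = begin
  u (d +ₙ (c +ₙ (c +ₙ x)))            ≡⟨ cong u (swap₂ d c x) ⟩
  u (c +ₙ (c +ₙ (d +ₙ x)))            ≡⟨ step (d +ₙ x) ⟩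
  p * u (c +ₙ (d +ₙ x)) - u (d +ₙ x) ≡⟨ cong (λ i → p * u i - u (d +ₙ x)) (swap d c x) ⟨
  p * u (d +ₙ (c +ₙ x)) - u (d +ₙ x) ∎
  where
  x : ℕ
  x = m *ₙ c
  swap : ∀ d c x → d +ₙ (c +ₙ x) ≡ c +ₙ (d +ₙ x)
  swap = ℕ-Solver.solve-∀
  swap₂ : ∀ d c x → d +ₙ (c +ₙ (c +ₙ x)) ≡ c +ₙ (c +ₙ (d +ₙ x))
  swap₂ = ℕ-Solver.solve-∀

bisection-homogeneous : ∀ u → FibonacciLike u → ∀ d → Homogeneous (+ 3) (λ m → u (d +ₙ m *ₙ 2))
bisection-homogeneous u u-rec = section-homogeneous {u} 2 (fibonacciLike-bisection {u} u-rec)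

quadrisection-homogeneous : ∀ u → FibonacciLike u → ∀ d → Homogeneous (+ 7) (λ m → u (d +ₙ m *ₙ 4))
quadrisection-homogeneous u u-rec = section-homogeneous {u} 4 (fibonacciLike-quadrisection {u} u-rec)

module _ {p : ℤ} {x y : ℕ → ℤ} where

  homogeneous-+ : Homogeneous p x → Homogeneous p y → Homogeneous p (λ m → x m + y m)
  homogeneous-+ hx hy .homogeneous-step m = begin
    x (suc (suc m)) + y (suc (suc m))
      ≡⟨ cong₂ _+_ (hx .homogeneous-step m) (hy .homogeneous-step m) ⟩
    (p * x (suc m) - x m) + (p * y (suc m) - y m)
      ≡⟨ collect p (x (suc m)) (x m) (y (suc m)) (y m) ⟩
    p * (x (suc m) + y (suc m)) - (x m + y m) ∎
    where
    collect : ∀ p x₁ x₀ y₁ y₀ → (p * x₁ - x₀) + (p * y₁ - y₀) ≡ p * (x₁ + y₁) - (x₀ + y₀)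
    collect = ℤ-Solver.solve-∀

  homogeneous-sum-recurrence : ∀ {q} → Homogeneous p x → Homogeneous q y →
                               Recurrence p (λ m → (q - p) * y (suc m)) (λ m → x m + y m)
  homogeneous-sum-recurrence {q} hx hy .recurrence-step m = begin
    x (suc (suc m)) + y (suc (suc m))
      ≡⟨ cong₂ _+_ (hx .homogeneous-step m) (hy .homogeneous-step m) ⟩
    (p * x (suc m) - x m) + (q * y (suc m) - y m)
      ≡⟨ collect p q (x (suc m)) (x m) (y (suc m)) (y m) ⟩
    p * (x (suc m) + y (suc m)) - (x m + y m) + (q - p) * y (suc m) ∎
    where
    collect : ∀ p q x₁ x₀ y₁ y₀ →
              (p * x₁ - x₀) + (q * y₁ - y₀) ≡ p * (x₁ + y₁) - (x₀ + y₀) + (q - p) * y₁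
    collect = ℤ-Solver.solve-∀

homogeneous-scale : ∀ {p x} c → Homogeneous p x → Homogeneous p (λ m → c * x m)
homogeneous-scale {p} {x} c hx .homogeneous-step m = begin
  c * x (suc (suc m))           ≡⟨ cong (c *_) (hx .homogeneous-step m) ⟩
  c * (p * x (suc m) - x m)     ≡⟨ distrib c p (x (suc m)) (x m) ⟩
  p * (c * x (suc m)) - c * x m ∎
  where
  distrib : ∀ c p x₁ x₀ → c * (p * x₁ - x₀) ≡ p * (c * x₁) - c * x₀
  distrib = ℤ-Solver.solve-∀

recurrence-scale : ∀ {p r x} c → Recurrence p r x → Recurrence p (λ m → c * r m) (λ m → c * x m)
recurrence-scale {p} {r} {x} c rx .recurrence-step m = begin
  c * x (suc (suc m))                       ≡⟨ cong (c *_) (rx .recurrence-step m) ⟩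
  c * (p * x (suc m) - x m + r m)           ≡⟨ distrib c p (x (suc m)) (x m) (r m) ⟩
  p * (c * x (suc m)) - c * x m + c * r m   ∎
  where
  distrib : ∀ c p x₁ x₀ r → c * (p * x₁ - x₀ + r) ≡ p * (c * x₁) - c * x₀ + c * r
  distrib = ℤ-Solver.solve-∀

recurrence-cong-forcing : ∀ {p r s x} → (∀ m → r m ≡ s m) → Recurrence p r x → Recurrence p s x
recurrence-cong-forcing {p} {x = x} r≡s rx .recurrence-step m =
  trans (rx .recurrence-step m) (cong (λ z → p * x (suc m) - x m + z) (r≡s m))

recurrence-unique : ∀ {p r x y} → Recurrence p r x → Recurrence p r y →
                    x 0 ≡ y 0 → x 1 ≡ y 1 → ∀ m → x m ≡ y m
recurrence-unique rx ry x₀≡y₀ x₁≡y₁ zero = x₀≡y₀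
recurrence-unique rx ry x₀≡y₀ x₁≡y₁ (suc zero) = x₁≡y₁
recurrence-unique {p} {r} {x} {y} rx ry x₀≡y₀ x₁≡y₁ (suc (suc m)) = begin
  x (suc (suc m))                 ≡⟨ rx .recurrence-step m ⟩
  p * x (suc m) - x m + r m       ≡⟨ cong₂ (λ u v → p * u - v + r m) (unique (suc m)) (unique m) ⟩
  p * y (suc m) - y m + r m       ≡⟨ ry .recurrence-step m ⟨
  y (suc (suc m))                 ∎
  where
  unique : ∀ m → x m ≡ y m
  unique = recurrence-unique rx ry x₀≡y₀ x₁≡y₁

sumFrom-cong : ∀ s t {f g : ℕ → ℤ} → (∀ k → s ≤ k → k < s +ₙ t → f k ≡ g k) →
               sumFrom s t f ≡ sumFrom s t g
sumFrom-cong s zero f≡g = refl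
sumFrom-cong s (suc t) f≡g =
  cong₂ _+_ (f≡g s ≤-refl (m<m+n s z<s))
            (sumFrom-cong (suc s) t (λ k s<k k<end → f≡g k (<⇒≤ s<k) (subst (k <_) (sym (+-suc s t)) k<end)))

sumFrom-snoc : ∀ s t (f : ℕ → ℤ) → sumFrom s (suc t) f ≡ sumFrom s t f + f (s +ₙ t)
sumFrom-snoc s zero f = begin
  f s + + 0   ≡⟨ +-identityʳ (f s) ⟩
  f s         ≡⟨ +-identityˡ (f s) ⟨
  + 0 + f s   ≡⟨ cong (λ i → + 0 + f i) (ℕₚ.+-identityʳ s) ⟨
  + 0 + f (s +ₙ 0) ∎
sumFrom-snoc s (suc t) f = begin
  f s + sumFrom (suc s) (suc t) f             ≡⟨ cong (λ z → f s + z) (sumFrom-snoc (suc s) t f) ⟩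
  f s + (sumFrom (suc s) t f + f (suc s +ₙ t)) ≡⟨ +-assoc (f s) _ _ ⟨
  f s + sumFrom (suc s) t f + f (suc s +ₙ t)   ≡⟨ cong (λ i → f s + sumFrom (suc s) t f + f i) (+-suc s t) ⟨
  f s + sumFrom (suc s) t f + f (s +ₙ suc t)   ∎

sumFrom-linear : ∀ s t p (f g : ℕ → ℤ) →
                 sumFrom s t (λ k → p * f k - g k) ≡ p * sumFrom s t f - sumFrom s t g
sumFrom-linear s zero p f g = empty p
  where
  empty : ∀ p → + 0 ≡ p * + 0 - + 0
  empty = ℤ-Solver.solve-∀
sumFrom-linear s (suc t) p f g = begin
  (p * f s - g s) + sumFrom (suc s) t (λ k → p * f k - g k)
    ≡⟨ cong (λ z → (p * f s - g s) + z) (sumFrom-linear (suc s) t p f g) ⟩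
  (p * f s - g s) + (p * sumFrom (suc s) t f - sumFrom (suc s) t g)
    ≡⟨ collect p (f s) (g s) (sumFrom (suc s) t f) (sumFrom (suc s) t g) ⟩
  p * (f s + sumFrom (suc s) t f) - (g s + sumFrom (suc s) t g) ∎
  where
  collect : ∀ p a b A B → (p * a - b) + (p * A - B) ≡ p * (a + A) - (b + B)
  collect = ℤ-Solver.solve-∀

convolution : (ℕ → ℤ) → (ℕ → ℤ) → ℕ → ℤ
convolution a g m = sumFrom 0 (suc m) (λ k → a k * g (m ∸ k))

convolution-termwise : ∀ a g (h : ℕ → ℤ) m → (∀ k → k ≤ m → a k * g (m ∸ k) ≡ h k) →
                    convolution a g m ≡ sumFrom 0 (suc m) h
convolution-termwise a g h m termwise = sumFrom-cong 0 (suc m) (λ k _ k≤m → termwise k (≤-pred k≤m))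

convolution-suc : ∀ a g m → convolution a g (suc m) ≡ convolution a (λ i → g (suc i)) m + a (suc m) * g 0
convolution-suc a g m = begin
  convolution a g (suc m)
    ≡⟨ sumFrom-snoc 0 (suc m) (λ k → a k * g (suc m ∸ k)) ⟩
  sumFrom 0 (suc m) (λ k → a k * g (suc m ∸ k)) + a (suc m) * g (m ∸ m)
    ≡⟨ cong₂ _+_ (sym (convolution-termwise a (λ i → g (suc i)) _ m shifted)) (cong (λ i → a (suc m) * g i) (n∸n≡0 m)) ⟩
  convolution a (λ i → g (suc i)) m + a (suc m) * g 0 ∎
  where
  shifted : ∀ k → k ≤ m → a k * g (suc (m ∸ k)) ≡ a k * g (suc m ∸ k)
  shifted k k≤m = cong (λ i → a k * g i) (sym (+-∸-assoc 1 k≤m))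

convolution-linear : ∀ a f g {h : ℕ → ℤ} p → (∀ i → h i ≡ p * f i - g i) →
                     ∀ m → convolution a h m ≡ p * convolution a f m - convolution a g m
convolution-linear a f g {h} p h≡ m = begin
  convolution a h m
    ≡⟨ convolution-termwise a h _ m (λ k _ → termwise k) ⟩
  sumFrom 0 (suc m) (λ k → p * (a k * f (m ∸ k)) - a k * g (m ∸ k))
    ≡⟨ sumFrom-linear 0 (suc m) p _ _ ⟩
  p * convolution a f m - convolution a g m ∎
  where
  distrib : ∀ a p x y → a * (p * x - y) ≡ p * (a * x) - a * y
  distrib = ℤ-Solver.solve-∀
  termwise : ∀ k → a k * h (m ∸ k) ≡ p * (a k * f (m ∸ k)) - a k * g (m ∸ k)
  termwise k = trans (cong (a k *_) (h≡ (m ∸ k))) (distrib (a k) p _ _)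

convolutionForcing : ℤ → (ℕ → ℤ) → (ℕ → ℤ) → ℕ → ℤ
convolutionForcing p a g m = a (suc m) * (g 1 - p * g 0) + a (suc (suc m)) * g 0

convolution-recurrence : ∀ {p} a {g} → Homogeneous p g →
                         Recurrence p (convolutionForcing p a g) (convolution a g)
convolution-recurrence {p} a {g} hg .recurrence-step m = begin
  convolution a g (suc (suc m))
    ≡⟨ convolution-suc a g (suc m) ⟩
  convolution a g₁ (suc m) + A₂ * g 0
    ≡⟨ cong (_+ A₂ * g 0) (convolution-suc a g₁ m) ⟩
  convolution a g₂ m + A₁ * g 1 + A₂ * g 0
    ≡⟨ cong (λ z → z + A₁ * g 1 + A₂ * g 0) (convolution-linear a g₁ g p (hg .homogeneous-step) m) ⟩
  p * convolution a g₁ m - convolution a g m + A₁ * g 1 + A₂ * g 0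
    ≡⟨ regroup p (convolution a g₁ m) (convolution a g m) A₁ A₂ (g 0) (g 1) ⟩
  p * (convolution a g₁ m + A₁ * g 0) - convolution a g m + convolutionForcing p a g m
    ≡⟨ cong (λ z → p * z - convolution a g m + convolutionForcing p a g m) (convolution-suc a g m) ⟨
  p * convolution a g (suc m) - convolution a g m + convolutionForcing p a g m ∎
  where
  g₁ g₂ : ℕ → ℤ
  g₁ i = g (suc i)
  g₂ i = g (suc (suc i))
  A₁ A₂ : ℤ
  A₁ = a (suc m)
  A₂ = a (suc (suc m))
  regroup : ∀ p C₁ C₀ A₁ A₂ g₀ g₁ →
            p * C₁ - C₀ + A₁ * g₁ + A₂ * g₀ ≡ p * (C₁ + A₁ * g₀) - C₀ + (A₁ * (g₁ - p * g₀) + A₂ * g₀)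
  regroup = ℤ-Solver.solve-∀

convolution-closedForm : ∀ {p q} c a {g x y : ℕ → ℤ} →
  Homogeneous p g → Homogeneous p x → Homogeneous q y →
  (∀ m → (q - p) * y (suc m) ≡ c * convolutionForcing p a g m) →
  x 0 + y 0 ≡ c * convolution a g 0 → x 1 + y 1 ≡ c * convolution a g 1 →
  ∀ m → x m + y m ≡ c * convolution a g m
convolution-closedForm c a hg hx hy forcing =
  recurrence-unique (recurrence-cong-forcing forcing (homogeneous-sum-recurrence hx hy))
                    (recurrence-scale c (convolution-recurrence a hg))

scaled-distance : ∀ d e {k m} → k ≤ m →
                  (d +ₙ e) *ₙ suc m ∸ (d +ₙ e) *ₙ k ∸ e ≡ d +ₙ (m ∸ k) *ₙ (d +ₙ e)
scaled-distance d e {k} k≤m with m≤n⇒∃[o]m+o≡n k≤m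
... | j , refl = begin
  (d +ₙ e) *ₙ suc (k +ₙ j) ∸ (d +ₙ e) *ₙ k ∸ e
    ≡⟨ cong (λ i → i ∸ (d +ₙ e) *ₙ k ∸ e) (expand d e k j) ⟩
  (d +ₙ e) *ₙ k +ₙ (e +ₙ (d +ₙ j *ₙ (d +ₙ e))) ∸ (d +ₙ e) *ₙ k ∸ e
    ≡⟨ cong (_∸ e) (m+n∸m≡n ((d +ₙ e) *ₙ k) _) ⟩
  e +ₙ (d +ₙ j *ₙ (d +ₙ e)) ∸ e
    ≡⟨ m+n∸m≡n e _ ⟩
  d +ₙ j *ₙ (d +ₙ e)
    ≡⟨ cong (λ i → d +ₙ i *ₙ (d +ₙ e)) (m+n∸m≡n k j) ⟨
  d +ₙ (k +ₙ j ∸ k) *ₙ (d +ₙ e) ∎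
  where
  expand : ∀ d e k j → (d +ₙ e) *ₙ suc (k +ₙ j) ≡ (d +ₙ e) *ₙ k +ₙ (e +ₙ (d +ₙ j *ₙ (d +ₙ e)))
  expand = ℕ-Solver.solve-∀

convolution-reindex : ∀ d e {a b : ℕ → ℤ} → (∀ k → a k ≡ b k) → ∀ m →
  convolution a (λ i → L (d +ₙ i *ₙ (d +ₙ e))) m
    ≡ sumFrom 0 (suc m) (λ k → b k * L ((d +ₙ e) *ₙ suc m ∸ (d +ₙ e) *ₙ k ∸ e))
convolution-reindex d e {a} a≡b m =
  convolution-termwise a (λ i → L (d +ₙ i *ₙ (d +ₙ e))) _ m
    (λ k k≤m → cong₂ (λ x i → x * L i) (a≡b k) (sym (scaled-distance d e k≤m)))

identity₁ : ∀ m → + 3 * F (2 *ₙ suc m ∸ 1)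
                  ≡ L (4 *ₙ suc m ∸ 2) - + 4 * sumFrom 1 m (λ k → F (2 *ₙ k) * L (4 *ₙ suc m ∸ 4 *ₙ k ∸ 2))
identity₁ m = begin
  + 3 * F (2 *ₙ suc m ∸ 1)        ≡⟨ cong (λ i → + 3 * F i) (scaled-distance 1 1 {m = m} z≤n) ⟩
  + 3 * F (1 +ₙ m *ₙ 2)           ≡⟨ isolate (x m) (F (1 +ₙ m *ₙ 2)) ⟩
  x m - (x m + y m)               ≡⟨ cong (λ z → x m - z) (closedForm m) ⟩
  x m - + 4 * convolution a g m   ≡⟨ cong₂ (λ i s → L i - + 4 * s) (sym (scaled-distance 2 2 {m = m} z≤n)) sum ⟩
  L (4 *ₙ suc m ∸ 2) - + 4 * sumFrom 1 m (λ k → F (2 *ₙ k) * L (4 *ₙ suc m ∸ 4 *ₙ k ∸ 2)) ∎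
  where
  a g x y : ℕ → ℤ
  a k = F (k *ₙ 2)
  g i = L (2 +ₙ i *ₙ 4)
  x i = L (2 +ₙ i *ₙ 4)
  y i = - + 3 * F (1 +ₙ i *ₙ 2)
  -- A = F (2i + 2), B = F (2i + 3); the forcing's a (i + 2) = F (2i + 4) unfolds to B + A.
  balance : ∀ A B → (+ 3 - + 7) * (- + 3 * B) ≡ + 4 * (A * (+ 18 - + 7 * + 3) + (B + A) * + 3)
  balance = ℤ-Solver.solve-∀
  closedForm : ∀ i → x i + y i ≡ + 4 * convolution a g i
  closedForm = convolution-closedForm (+ 4) a
    (quadrisection-homogeneous L L-fibonacciLike 2)
    (quadrisection-homogeneous L L-fibonacciLike 2)
    (homogeneous-scale (- + 3) (bisection-homogeneous F F-fibonacciLike 1))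
    (λ i → balance (F (suc i *ₙ 2)) (F (1 +ₙ suc i *ₙ 2)))
    refl refl
  isolate : ∀ u v → + 3 * v ≡ u - (u + - + 3 * v)
  isolate = ℤ-Solver.solve-∀
  -- The k = 0 term F 0 * _ reduces to + 0, leaving + 0 + sumFrom 1 m _.
  sum : convolution a g m ≡ sumFrom 1 m (λ k → F (2 *ₙ k) * L (4 *ₙ suc m ∸ 4 *ₙ k ∸ 2))
  sum = trans (convolution-reindex 2 2 (λ k → cong F (*-comm k 2)) m) (+-identityˡ _)

identity₂ : ∀ m → + 2 * F (2 *ₙ suc m ∸ 1) - + 5 * F (2 *ₙ suc m ∸ 2)
                  ≡ L (4 *ₙ suc m ∸ 4) - + 4 * sumFrom 1 m (λ k → F (2 *ₙ k) * L (4 *ₙ suc m ∸ 4 *ₙ k ∸ 4))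
identity₂ m = begin
  + 2 * F (2 *ₙ suc m ∸ 1) - + 5 * F (2 *ₙ suc m ∸ 2)
    ≡⟨ cong₂ (λ i j → + 2 * F i - + 5 * F j) (scaled-distance 1 1 {m = m} z≤n) (scaled-distance 0 2 {m = m} z≤n) ⟩
  + 2 * F (1 +ₙ m *ₙ 2) - + 5 * F (m *ₙ 2)
    ≡⟨ isolate (x m) (F (m *ₙ 2)) (F (1 +ₙ m *ₙ 2)) ⟩
  x m - (x m + y m)
    ≡⟨ cong (λ z → x m - z) (closedForm m) ⟩
  x m - + 4 * convolution a g m
    ≡⟨ cong₂ (λ i s → L i - + 4 * s) (sym (scaled-distance 0 4 {m = m} z≤n)) sum ⟩
  L (4 *ₙ suc m ∸ 4) - + 4 * sumFrom 1 m (λ k → F (2 *ₙ k) * L (4 *ₙ suc m ∸ 4 *ₙ k ∸ 4)) ∎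
  where
  a g x y : ℕ → ℤ
  a k = F (k *ₙ 2)
  g i = L (i *ₙ 4)
  x i = L (i *ₙ 4)
  y i = + 5 * F (i *ₙ 2) + - + 2 * F (1 +ₙ i *ₙ 2)
  balance : ∀ A B → (+ 3 - + 7) * (+ 5 * A + - + 2 * B) ≡ + 4 * (A * (+ 7 - + 7 * + 2) + (B + A) * + 2)
  balance = ℤ-Solver.solve-∀
  closedForm : ∀ i → x i + y i ≡ + 4 * convolution a g i
  closedForm = convolution-closedForm (+ 4) a
    (quadrisection-homogeneous L L-fibonacciLike 0)
    (quadrisection-homogeneous L L-fibonacciLike 0)
    (homogeneous-+ (homogeneous-scale (+ 5) (bisection-homogeneous F F-fibonacciLike 0))
                   (homogeneous-scale (- + 2) (bisection-homogeneous F F-fibonacciLike 1)))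
    (λ i → balance (F (suc i *ₙ 2)) (F (1 +ₙ suc i *ₙ 2)))
    refl refl
  isolate : ∀ u v w → + 2 * w - + 5 * v ≡ u - (u + (+ 5 * v + - + 2 * w))
  isolate = ℤ-Solver.solve-∀
  sum : convolution a g m ≡ sumFrom 1 m (λ k → F (2 *ₙ k) * L (4 *ₙ suc m ∸ 4 *ₙ k ∸ 4))
  sum = trans (convolution-reindex 0 4 (λ k → cong F (*-comm k 2)) m) (+-identityˡ _)

identity₃ : ∀ m → + 2 * F (4 *ₙ suc m +ₙ 2) - + 3 * F (4 *ₙ suc m ∸ 2)
                  ≡ L (2 *ₙ suc m) + L (2 *ₙ suc m ∸ 2)
                    + + 4 * sumFrom 0 (suc m) (λ k → F (4 *ₙ k +ₙ 2) * L (2 *ₙ suc m ∸ 2 *ₙ k ∸ 2))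
identity₃ m = begin
  + 2 * F (4 *ₙ suc m +ₙ 2) - + 3 * F (4 *ₙ suc m ∸ 2)
    ≡⟨ cong₂ (λ i j → + 2 * F i - + 3 * F j) (top m) (scaled-distance 2 2 {m = m} z≤n) ⟩
  + 2 * F (6 +ₙ m *ₙ 4) - + 3 * F (2 +ₙ m *ₙ 4)
    ≡⟨ isolate (L (2 +ₙ m *ₙ 2)) (L (m *ₙ 2)) (F (6 +ₙ m *ₙ 4)) (F (2 +ₙ m *ₙ 4)) ⟩
  L (2 +ₙ m *ₙ 2) + L (m *ₙ 2) + (x m + y m)
    ≡⟨ cong (λ z → L (2 +ₙ m *ₙ 2) + L (m *ₙ 2) + z) (closedForm m) ⟩
  L (2 +ₙ m *ₙ 2) + L (m *ₙ 2) + + 4 * convolution a g m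
    ≡⟨ cong₂ (λ i j → L i + L j + + 4 * convolution a g m)
             (sym (scaled-distance 2 0 {m = m} z≤n)) (sym (scaled-distance 0 2 {m = m} z≤n)) ⟩
  L (2 *ₙ suc m) + L (2 *ₙ suc m ∸ 2) + + 4 * convolution a g m
    ≡⟨ cong (λ s → L (2 *ₙ suc m) + L (2 *ₙ suc m ∸ 2) + + 4 * s)
            (convolution-reindex 0 2 (λ k → cong F (offset k)) m) ⟩
  L (2 *ₙ suc m) + L (2 *ₙ suc m ∸ 2)
    + + 4 * sumFrom 0 (suc m) (λ k → F (4 *ₙ k +ₙ 2) * L (2 *ₙ suc m ∸ 2 *ₙ k ∸ 2)) ∎
  where
  a g x y : ℕ → ℤ
  a k = F (2 +ₙ k *ₙ 4)
  g i = L (i *ₙ 2)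
  x i = - + 1 * (L (2 +ₙ i *ₙ 2) + L (i *ₙ 2))
  y i = + 2 * F (6 +ₙ i *ₙ 4) + - + 3 * F (2 +ₙ i *ₙ 4)
  balance : ∀ A B → (+ 7 - + 3) * (+ 2 * B + - + 3 * A) ≡ + 4 * (A * (+ 3 - + 3 * + 2) + B * + 2)
  balance = ℤ-Solver.solve-∀
  closedForm : ∀ i → x i + y i ≡ + 4 * convolution a g i
  closedForm = convolution-closedForm (+ 4) a
    (bisection-homogeneous L L-fibonacciLike 0)
    (homogeneous-scale (- + 1) (homogeneous-+ (bisection-homogeneous L L-fibonacciLike 2)
                                              (bisection-homogeneous L L-fibonacciLike 0)))
    (homogeneous-+ (homogeneous-scale (+ 2) (quadrisection-homogeneous F F-fibonacciLike 6))
                   (homogeneous-scale (- + 3) (quadrisection-homogeneous F F-fibonacciLike 2)))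
    (λ i → balance (F (2 +ₙ suc i *ₙ 4)) (F (2 +ₙ suc (suc i) *ₙ 4)))
    refl refl
  isolate : ∀ u v A B → + 2 * A - + 3 * B ≡ u + v + (- + 1 * (u + v) + (+ 2 * A + - + 3 * B))
  isolate = ℤ-Solver.solve-∀
  top : ∀ i → 4 *ₙ suc i +ₙ 2 ≡ 6 +ₙ i *ₙ 4
  top = ℕ-Solver.solve-∀
  offset : ∀ k → 2 +ₙ k *ₙ 4 ≡ 4 *ₙ k +ₙ 2
  offset = ℕ-Solver.solve-∀

identity₄ : ∀ m → + 2 * F (4 *ₙ suc m) - + 3 * F (4 *ₙ suc m ∸ 4)
                  ≡ + 3 * L (2 *ₙ suc m ∸ 2) + + 4 * sumFrom 1 m (λ k → F (4 *ₙ k) * L (2 *ₙ suc m ∸ 2 *ₙ k ∸ 2))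
identity₄ m = begin
  + 2 * F (4 *ₙ suc m) - + 3 * F (4 *ₙ suc m ∸ 4)
    ≡⟨ cong₂ (λ i j → + 2 * F i - + 3 * F j) (scaled-distance 4 0 {m = m} z≤n) (scaled-distance 0 4 {m = m} z≤n) ⟩
  + 2 * F (4 +ₙ m *ₙ 4) - + 3 * F (m *ₙ 4)
    ≡⟨ isolate (L (m *ₙ 2)) (F (4 +ₙ m *ₙ 4)) (F (m *ₙ 4)) ⟩
  + 3 * L (m *ₙ 2) + (x m + y m)
    ≡⟨ cong (λ z → + 3 * L (m *ₙ 2) + z) (closedForm m) ⟩
  + 3 * L (m *ₙ 2) + + 4 * convolution a g m
    ≡⟨ cong₂ (λ i s → + 3 * L i + + 4 * s) (sym (scaled-distance 0 2 {m = m} z≤n)) sum ⟩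
  + 3 * L (2 *ₙ suc m ∸ 2) + + 4 * sumFrom 1 m (λ k → F (4 *ₙ k) * L (2 *ₙ suc m ∸ 2 *ₙ k ∸ 2)) ∎
  where
  a g x y : ℕ → ℤ
  a k = F (k *ₙ 4)
  g i = L (i *ₙ 2)
  x i = - + 3 * L (i *ₙ 2)
  y i = + 2 * F (4 +ₙ i *ₙ 4) + - + 3 * F (i *ₙ 4)
  balance : ∀ A B → (+ 7 - + 3) * (+ 2 * B + - + 3 * A) ≡ + 4 * (A * (+ 3 - + 3 * + 2) + B * + 2)
  balance = ℤ-Solver.solve-∀
  closedForm : ∀ i → x i + y i ≡ + 4 * convolution a g i
  closedForm = convolution-closedForm (+ 4) a
    (bisection-homogeneous L L-fibonacciLike 0)
    (homogeneous-scale (- + 3) (bisection-homogeneous L L-fibonacciLike 0))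
    (homogeneous-+ (homogeneous-scale (+ 2) (quadrisection-homogeneous F F-fibonacciLike 4))
                   (homogeneous-scale (- + 3) (quadrisection-homogeneous F F-fibonacciLike 0)))
    (λ i → balance (F (suc i *ₙ 4)) (F (suc (suc i) *ₙ 4)))
    refl refl
  isolate : ∀ v A B → + 2 * A - + 3 * B ≡ + 3 * v + (- + 3 * v + (+ 2 * A + - + 3 * B))
  isolate = ℤ-Solver.solve-∀
  sum : convolution a g m ≡ sumFrom 1 m (λ k → F (4 *ₙ k) * L (2 *ₙ suc m ∸ 2 *ₙ k ∸ 2))
  sum = trans (convolution-reindex 0 2 (λ k → cong F (*-comm k 4)) m) (+-identityˡ _)

corollary12 : (n : ℕ) → n ≥ 1 →
    (+ 3 * F (2 *ₙ n ∸ 1)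
    ≡ L (4 *ₙ n ∸ 2) - + 4 * sumFrom 1 (n ∸ 1) (λ k → F (2 *ₙ k) * L (4 *ₙ n ∸ 4 *ₙ k ∸ 2)))
    × (+ 2 * F (2 *ₙ n ∸ 1) - + 5 * F (2 *ₙ n ∸ 2)
    ≡ L (4 *ₙ n ∸ 4) - + 4 * sumFrom 1 (n ∸ 1) (λ k → F (2 *ₙ k) * L (4 *ₙ n ∸ 4 *ₙ k ∸ 4)))
    × (+ 2 * F (4 *ₙ n +ₙ 2) - + 3 * F (4 *ₙ n ∸ 2)
    ≡ L (2 *ₙ n) + L (2 *ₙ n ∸ 2) + + 4 * sumFrom 0 n (λ k → F (4 *ₙ k +ₙ 2) * L (2 *ₙ n ∸ 2 *ₙ k ∸ 2)))
    × (+ 2 * F (4 *ₙ n) - + 3 * F (4 *ₙ n ∸ 4)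
    ≡ + 3 * L (2 *ₙ n ∸ 2) + + 4 * sumFrom 1 (n ∸ 1) (λ k → F (4 *ₙ k) * L (2 *ₙ n ∸ 2 *ₙ k ∸ 2)))
corollary12 zero ()
corollary12 (suc m) _ = identity₁ m , identity₂ m , identity₃ m , identity₄ m
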